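{- (i) Every one popular color graph $G$ has clique number $\omega(G)\leq 5$, and there exists a one popular color graph with clique number $5$. (ii) Every semiminimal Cayley graph $\mathrm{Cay}(\Gamma,C)$ has clique number $\omega(\mathrm{Cay}(\Gamma,C))\leq 4$, and there exists a semiminimal Cayley graph with clique number $4$.
   Context: A graph $G$ is a one popular color graph if its edges admit a coloring such that (1) each vertex is incident with at most two edges of any given color, and (2') every cycle of $G$ contains at least one color on at least two of its edges. For a group $\Gamma$ and a subset $C\subseteq\Gamma$, the Cayley graph $\mathrm{Cay}(\Gamma,C)$ is the undirected graph with vertex set $\Gamma$ in which $a,b$ are adjacent if $a^{ -1}b\in C$ (undirected even if $C$ is not inverse-closed). It is semiminimal if $C$ is a finite generating set of $\Gamma$ that admits a linear order $c_1,\dots,c_k$ such that for each $i$, $c_i\notin\langle c_1,\dots,c_{i-1}\rangle$. $\omega$ denotes the clique number. -}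

module Defs where

open import Level using (Level; _⊔_; 0ℓ) renaming (suc to lsuc)
open import Data.Nat using (ℕ; zero; suc; _+_; _%_)
open import Data.Nat.DivMod using (m%n<n)
open import Data.Fin using (Fin; toℕ; fromℕ<; _<_)
open import Data.Product using (Σ; _×_; _,_)
open import Data.Sum using (_⊎_)
open import Data.Empty using (⊥)
open import Relation.Nullary using (¬_)
open import Relation.Binary.PropositionalEquality using (_≡_; _≢_)
open import Function.Definitions using (Injective)
open import Algebra.Bundles using (Group)

record Graph (a ℓ : Level) : Set (lsuc (a ⊔ ℓ)) where
  field
    V      : Set a
    Adj    : V → V → Set ℓ
    sym    : ∀ {u v} → Adj u v → Adj v u
    irrefl : ∀ {v} → Adj v v → ⊥

IsClique : ∀ {a ℓ} {V : Set a} (R : V → V → Set ℓ) {n : ℕ} → (Fin n → V) → Set ℓ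
IsClique R f = ∀ i j → i ≢ j → R (f i) (f j)

CliqueNumberAtMost : ∀ {a ℓ} {V : Set a} (R : V → V → Set ℓ) → ℕ → Set (a ⊔ ℓ)
CliqueNumberAtMost {V = V} R n = (f : Fin (suc n) → V) → ¬ IsClique R f

CliqueNumber : ∀ {a ℓ} {V : Set a} (R : V → V → Set ℓ) → ℕ → Set (a ⊔ ℓ)
CliqueNumber {V = V} R n = Σ (Fin n → V) (IsClique R) × CliqueNumberAtMost R n

next : ∀ {n} → Fin (suc n) → Fin (suc n)
next {n} i = fromℕ< (m%n<n (suc (toℕ i)) (suc n))

-- One popular color colorings.
-- A colouring assigns to each (unordered) edge {u,v} the colour col u v
-- (values on non-adjacent pairs are irrelevant).

record OnePopularColoring {a ℓ k} (G : Graph a ℓ) (K : Set k)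
                          (col : Graph.V G → Graph.V G → K) : Set (a ⊔ ℓ ⊔ k) where
  open Graph G
  field
    symmetric : ∀ u v → Adj u v → col u v ≡ col v u
    atMostTwo : ∀ (v : V) (x : K) (u : Fin 3 → V) → Injective _≡_ _≡_ u →
                (∀ i → Adj v (u i)) → (∀ i → col v (u i) ≡ x) → ⊥
    popular : ∀ (m : ℕ) (w : Fin (3 + m) → V) → Injective _≡_ _≡_ w →
              (∀ i → Adj (w i) (w (next i))) →
              Σ (Fin (3 + m)) λ i → Σ (Fin (3 + m)) λ j →
                i ≢ j × col (w i) (w (next i)) ≡ col (w j) (w (next j))

OnePopular : ∀ {a ℓ} (G : Graph a ℓ) (k : Level) → Set (a ⊔ ℓ ⊔ lsuc k)
OnePopular G k = Σ (Set k) λ K → Σ (Graph.V G → Graph.V G → K) (OnePopularColoring G K)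

module _ {a ℓ} (Γ : Group a ℓ) where
  open Group Γ

  data ⟨_⟩ {s} (S : Carrier → Set s) : Carrier → Set (a ⊔ ℓ ⊔ s) where
    gen  : ∀ {x} → S x → ⟨ S ⟩ x
    unit : ⟨ S ⟩ ε
    mul  : ∀ {x y} → ⟨ S ⟩ x → ⟨ S ⟩ y → ⟨ S ⟩ (x ∙ y)
    inv  : ∀ {x} → ⟨ S ⟩ x → ⟨ S ⟩ (x ⁻¹)
    resp : ∀ {x y} → x ≈ y → ⟨ S ⟩ x → ⟨ S ⟩ y

  Img : ∀ {n} → (Fin n → Carrier) → Carrier → Set ℓ
  Img {n} c z = Σ (Fin n) λ j → z ≈ c j

  Before : ∀ {n} → (Fin n → Carrier) → Fin n → Carrier → Set ℓ
  Before {n} c i z = Σ (Fin n) λ j → j < i × z ≈ c j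

  CayAdj : ∀ {s} → (Carrier → Set s) → Carrier → Carrier → Set s
  CayAdj C x y = C (x ⁻¹ ∙ y) ⊎ C (y ⁻¹ ∙ x)

  SemiMinimal : ∀ {n} → (Fin n → Carrier) → Set (a ⊔ ℓ)
  SemiMinimal c = (∀ i → ¬ ⟨ Before c i ⟩ (c i)) × (∀ x → ⟨ Img c ⟩ x)

{-# OPTIONS --safe #-}
-- (i) Every triangle of a one popular colouring repeats a colour, so some vertex p
-- of a triangle p q r sees q and r in one colour α. Then p has no further α-edge,
-- and every further vertex w of the clique has an α-edge to q or to r (otherwise
-- the triangles p q w and p r w put three edges of one colour at w). As q and r
-- each admit only one more α-edge, at most two further vertices exist.
-- (ii) Label each edge of a Cayley clique by the index of its generator and take
-- an edge P Q of maximal label M. A further vertex joined to both P and Q by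
-- smaller labels would put P⁻¹Q, hence c M, into ⟨ c t | t < M ⟩. So every further
-- vertex is a (c M)^±1-neighbour of P or of Q, and each of P, Q has only one such
-- neighbour besides the other: the clique has at most four vertices.
-- The examples are K₅ coloured by pentagon and pentagram (two colours, so every
-- cycle repeats one) and Cay(ℤ₄, {2, 1}).
module Submission where

open import Defs
open import Level using (Level; 0ℓ; _⊔_)
open import Data.Nat using (ℕ; suc; _+_; _∸_; _≤_; z≤n; s≤s)
open import Data.Nat.DivMod using (_mod_)
open import Data.Nat.Divisibility using (_∣_; _∣?_)
open import Data.Nat.Properties using (1+n≰n; +-monoʳ-≤)
open import Data.Fin using (Fin; toℕ; _↑ʳ_; punchIn; punchOut) renaming (_≤_ to _≤ᶠ_)
open import Data.Fin.Patterns using (0F; 1F; 2F; 3F)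
open import Data.Fin.Properties
  using (_≟_; injective⇒≤; ↑ʳ-injective; pigeonhole; <⇒≢; all?; any?;
         punchIn-injective; punchInᵢ≢i; punchIn-punchOut; ≤-totalOrder; ≤∧≢⇒<)
open import Data.Bool using (if_then_else_; _∨_)
open import Data.Bool.Properties using (∨-comm)
open import Data.Product using (Σ; _×_; _,_; proj₁; proj₂; ∃-syntax)
open import Data.Sum as Sum using (_⊎_; inj₁; inj₂)
open import Data.List using (allFin)
import Data.List.Relation.Unary.All as All
open import Data.List.Membership.Propositional.Properties using (∈-allFin)
open import Relation.Binary.Bundles using (TotalOrder)
open import Data.Empty using (⊥; ⊥-elim)
open import Function using (_∘_)
open import Function.Definitions using (Injective)
open import Relation.Nullary using (¬_; yes; no; ¬?; ⌊_⌋)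
open import Relation.Nullary.Decidable using (from-yes; from-no; _→-dec_; _⊎-dec_)
open import Relation.Binary.PropositionalEquality
  using (_≡_; _≢_; refl; sym; trans; subst; cong; cong₂; isEquivalence; ≢-sym)
open import Algebra.Bundles using (Group)

private
  variable
    a k ℓ : Level
    A : Set a
    K : Set k
    m n : ℕ

cliqueSize≤⇒cliqueNumberAtMost : {R : A → A → Set ℓ} →
  (∀ {r} (f : Fin r → A) → IsClique R f → r ≤ n) → CliqueNumberAtMost R n
cliqueSize≤⇒cliqueNumberAtMost size≤ f f-clique = 1+n≰n (size≤ f f-clique)

SomeTwoEqual : A → A → A → Set _
SomeTwoEqual x y z = x ≡ y ⊎ x ≡ z ⊎ y ≡ z

triple : A → A → A → Fin 3 → A
triple x y z 0F = x
triple x y z 1F = y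
triple x y z 2F = z

triple-injective : {x y z : A} → x ≢ y → x ≢ z → y ≢ z → Injective _≡_ _≡_ (triple x y z)
triple-injective x≢y x≢z y≢z {0F} {0F} _   = refl
triple-injective x≢y x≢z y≢z {0F} {1F} x≡y = ⊥-elim (x≢y x≡y)
triple-injective x≢y x≢z y≢z {0F} {2F} x≡z = ⊥-elim (x≢z x≡z)
triple-injective x≢y x≢z y≢z {1F} {0F} y≡x = ⊥-elim (x≢y (sym y≡x))
triple-injective x≢y x≢z y≢z {1F} {1F} _   = refl
triple-injective x≢y x≢z y≢z {1F} {2F} y≡z = ⊥-elim (y≢z y≡z)
triple-injective x≢y x≢z y≢z {2F} {0F} z≡x = ⊥-elim (x≢z (sym z≡x))
triple-injective x≢y x≢z y≢z {2F} {1F} z≡y = ⊥-elim (y≢z (sym z≡y))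
triple-injective x≢y x≢z y≢z {2F} {2F} _   = refl

someTwoEqual-or-injective : (x y z : Fin n) →
  SomeTwoEqual x y z ⊎ Injective _≡_ _≡_ (triple x y z)
someTwoEqual-or-injective x y z with x ≟ y | x ≟ z | y ≟ z
... | yes x≡y | _       | _       = inj₁ (inj₁ x≡y)
... | no _    | yes x≡z | _       = inj₁ (inj₂ (inj₁ x≡z))
... | no _    | no _    | yes y≡z = inj₁ (inj₂ (inj₂ y≡z))
... | no x≢y  | no x≢z  | no y≢z  = inj₂ (triple-injective x≢y x≢z y≢z)

someTwoEqual⇒¬injective : {u : Fin 3 → A} → SomeTwoEqual (u 0F) (u 1F) (u 2F) →
  ¬ Injective _≡_ _≡_ u
someTwoEqual⇒¬injective (inj₁ e)        u-injective with () ← u-injective e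
someTwoEqual⇒¬injective (inj₂ (inj₁ e)) u-injective with () ← u-injective e
someTwoEqual⇒¬injective (inj₂ (inj₂ e)) u-injective with () ← u-injective e

repeatedEntry⇒someTwoEqual : (e : Fin 3 → A) → (∃[ i ] ∃[ j ] i ≢ j × e i ≡ e j) →
  SomeTwoEqual (e 0F) (e 1F) (e 2F)
repeatedEntry⇒someTwoEqual e (0F , 0F , i≢j , _) = ⊥-elim (i≢j refl)
repeatedEntry⇒someTwoEqual e (0F , 1F , _ , eq) = inj₁ eq
repeatedEntry⇒someTwoEqual e (0F , 2F , _ , eq) = inj₂ (inj₁ eq)
repeatedEntry⇒someTwoEqual e (1F , 0F , _ , eq) = inj₁ (sym eq)
repeatedEntry⇒someTwoEqual e (1F , 1F , i≢j , _) = ⊥-elim (i≢j refl)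
repeatedEntry⇒someTwoEqual e (1F , 2F , _ , eq) = inj₂ (inj₂ eq)
repeatedEntry⇒someTwoEqual e (2F , 0F , _ , eq) = inj₂ (inj₁ (sym eq))
repeatedEntry⇒someTwoEqual e (2F , 1F , _ , eq) = inj₂ (inj₂ (sym eq))
repeatedEntry⇒someTwoEqual e (2F , 2F , i≢j , _) = ⊥-elim (i≢j refl)

clique-injective : {R : A → A → Set ℓ} → (∀ {v} → ¬ R v v) →
  {f : Fin n → A} → IsClique R f → Injective _≡_ _≡_ f
clique-injective {R = R} irreflexive {f} f-clique {i} {j} fi≡fj with i ≟ j
... | yes i≡j = i≡j
... | no i≢j  = ⊥-elim (irreflexive (subst (R (f i)) (sym fi≡fj) (f-clique i j i≢j)))

AtMostTwoSuccessors : (A → A → Set ℓ) → Set _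
AtMostTwoSuccessors E = ∀ {x y₁ y₂ y₃} → E x y₁ → E x y₂ → E x y₃ → SomeTwoEqual y₁ y₂ y₃

-- w ↦ (a hub of o w) is injective: each hub spends one of its two successors on its spare.
coveredByTwoHubs⇒≤2 : {E : A → A → Set ℓ} → AtMostTwoSuccessors E →
  (hub spare : Fin 2 → A) → (∀ q → E (hub q) (spare q)) →
  (o : Fin m → A) → Injective _≡_ _≡_ o → (∀ q w → spare q ≢ o w) →
  (∀ w → ∃[ q ] E (hub q) (o w)) → m ≤ 2
coveredByTwoHubs⇒≤2 {E = E} atMostTwo hub spare hub→spare o o-injective spare≢o cover =
  injective⇒≤ partner-injective
  where
  hub-has-one-more : ∀ q {w w′} → E (hub q) (o w) → E (hub q) (o w′) → w ≡ w′
  hub-has-one-more q e e′ with atMostTwo (hub→spare q) e e′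
  ... | inj₁ spare≡o           = ⊥-elim (spare≢o q _ spare≡o)
  ... | inj₂ (inj₁ spare≡o′)   = ⊥-elim (spare≢o q _ spare≡o′)
  ... | inj₂ (inj₂ o≡o′)       = o-injective o≡o′

  partner-injective : Injective _≡_ _≡_ (proj₁ ∘ cover)
  partner-injective {w} {w′} same = hub-has-one-more _ (proj₂ (cover w))
    (subst (λ q → E (hub q) (o w′)) (sym same) (proj₂ (cover w′)))

ColourClass : (A → A → Set ℓ) → (A → A → K) → K → A → A → Set _
ColourClass Adj χ x u v = Adj u v × χ u v ≡ x

record IsTrianglePopular {A : Set a} {K : Set k} (χ : A → A → K) : Set (a ⊔ k) where
  field
    symmetric : ∀ {p q} → p ≢ q → χ p q ≡ χ q p
    atMostTwo : ∀ x → AtMostTwoSuccessors (ColourClass _≢_ χ x)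
    triangle  : ∀ {p q r} → p ≢ q → q ≢ r → r ≢ p → SomeTwoEqual (χ p q) (χ q r) (χ r p)

module _ {χ : A → A → K} (χ-popular : IsTrianglePopular χ) where
  open IsTrianglePopular χ-popular

  pivot⇒≤2 : (o : Fin m → A) → Injective _≡_ _≡_ o →
             ∀ {p q r} → (∀ w → p ≢ o w) → (∀ w → q ≢ o w) → (∀ w → r ≢ o w) →
             p ≢ q → p ≢ r → q ≢ r → χ p q ≡ χ p r → m ≤ 2
  pivot⇒≤2 o o-injective {p} {q} {r} p≢o q≢o r≢o p≢q p≢r q≢r pivot =
    coveredByTwoHubs⇒≤2 {E = ColourClass _≢_ χ α}
      (atMostTwo α) hub (λ _ → p) hub→p o o-injective (λ _ → p≢o) cover
    where
    α : K
    α = χ p q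

    hub : Fin 2 → A
    hub 0F = q
    hub 1F = r

    hub≢p : ∀ i → hub i ≢ p
    hub≢p 0F = ≢-sym p≢q
    hub≢p 1F = ≢-sym p≢r

    hub≢o : ∀ i w → hub i ≢ o w
    hub≢o 0F = q≢o
    hub≢o 1F = r≢o

    p→hub : ∀ i → χ p (hub i) ≡ α
    p→hub 0F = refl
    p→hub 1F = sym pivot

    hub→p : ∀ i → ColourClass _≢_ χ α (hub i) p
    hub→p i = hub≢p i , trans (symmetric (hub≢p i)) (p→hub i)

    saturated : ∀ w → χ p (o w) ≢ α
    saturated w p→o with atMostTwo α (p≢q , refl) (p≢r , sym pivot) (p≢o w , p→o)
    ... | inj₁ q≡r         = q≢r q≡r
    ... | inj₂ (inj₁ q≡o)  = q≢o w q≡o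
    ... | inj₂ (inj₂ r≡o)  = r≢o w r≡o

    hub-colour : ∀ i w → χ (hub i) (o w) ≡ α ⊎ χ (hub i) (o w) ≡ χ (o w) p
    hub-colour i w with triangle (≢-sym (hub≢p i)) (hub≢o i w) (≢-sym (p≢o w))
    ... | inj₁ e           = inj₁ (trans (sym e) (p→hub i))
    ... | inj₂ (inj₁ e)    = ⊥-elim (saturated w
                               (trans (symmetric (p≢o w)) (trans (sym e) (p→hub i))))
    ... | inj₂ (inj₂ e)    = inj₂ e

    o→hub : ∀ i w → χ (hub i) (o w) ≡ χ (o w) p → χ (o w) (hub i) ≡ χ (o w) p
    o→hub i w e = trans (symmetric (≢-sym (hub≢o i w))) e

    cover : ∀ w → ∃[ i ] ColourClass _≢_ χ α (hub i) (o w)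
    cover w with hub-colour 0F w | hub-colour 1F w
    ... | inj₁ e | _      = 0F , q≢o w , e
    ... | inj₂ _ | inj₁ e = 1F , r≢o w , e
    ... | inj₂ e | inj₂ e′
      with atMostTwo (χ (o w) p) (≢-sym (p≢o w) , refl)
                                 (≢-sym (q≢o w) , o→hub 0F w e) (≢-sym (r≢o w) , o→hub 1F w e′)
    ...   | inj₁ p≡q        = ⊥-elim (p≢q p≡q)
    ...   | inj₂ (inj₁ p≡r) = ⊥-elim (p≢r p≡r)
    ...   | inj₂ (inj₂ q≡r) = ⊥-elim (q≢r q≡r)

trianglePopular-size≤5 : {χ : Fin n → Fin n → K} → IsTrianglePopular χ → n ≤ 5
trianglePopular-size≤5 {n = 0} _ = z≤n
trianglePopular-size≤5 {n = 1} _ = s≤s z≤n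
trianglePopular-size≤5 {n = 2} _ = s≤s (s≤s z≤n)
trianglePopular-size≤5 {n = suc (suc (suc m))} {χ = χ} χ-popular =
  +-monoʳ-≤ 3 (pivot-at (triangle (λ ()) (λ ()) (λ ())))
  where
  open IsTrianglePopular χ-popular

  o : Fin m → Fin (3 + m)
  o = 3 ↑ʳ_

  pivot-at : SomeTwoEqual (χ 0F 1F) (χ 1F 2F) (χ 2F 0F) → m ≤ 2
  pivot-at (inj₁ χ01≡χ12) = pivot⇒≤2 χ-popular o (↑ʳ-injective 3 _ _) {1F} {0F} {2F}
    (λ _ ()) (λ _ ()) (λ _ ()) (λ ()) (λ ()) (λ ()) (trans (symmetric (λ ())) χ01≡χ12)
  pivot-at (inj₂ (inj₁ χ01≡χ20)) = pivot⇒≤2 χ-popular o (↑ʳ-injective 3 _ _) {0F} {1F} {2F}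
    (λ _ ()) (λ _ ()) (λ _ ()) (λ ()) (λ ()) (λ ()) (trans χ01≡χ20 (symmetric (λ ())))
  pivot-at (inj₂ (inj₂ χ12≡χ20)) = pivot⇒≤2 χ-popular o (↑ʳ-injective 3 _ _) {2F} {0F} {1F}
    (λ _ ()) (λ _ ()) (λ _ ()) (λ ()) (λ ()) (λ ()) (sym (trans (symmetric (λ ())) χ12≡χ20))

module _ (G : Graph a ℓ) {col : Graph.V G → Graph.V G → K} where
  open Graph G using (V; Adj; irrefl)

  atMostTwoSuccessors⇒atMostTwo : (∀ x → AtMostTwoSuccessors (ColourClass Adj col x)) →
    ∀ v x (u : Fin 3 → V) → Injective _≡_ _≡_ u →
    (∀ i → Adj v (u i)) → (∀ i → col v (u i) ≡ x) → ⊥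
  atMostTwoSuccessors⇒atMostTwo atMostTwo v x u u-injective adj colour =
    someTwoEqual⇒¬injective
      (atMostTwo x (adj 0F , colour 0F) (adj 1F , colour 1F) (adj 2F , colour 2F)) u-injective

  clique-isTrianglePopular : OnePopularColoring G K col → {f : Fin n → V} → IsClique Adj f →
                             IsTrianglePopular (λ i j → col (f i) (f j))
  clique-isTrianglePopular col-popular {f} f-clique = record
    { symmetric = λ {p} {q} p≢q → OnePopularColoring.symmetric col-popular _ _ (f-clique p q p≢q)
    ; atMostTwo = atMostTwo′
    ; triangle  = triangle′
    }
    where
    open OnePopularColoring col-popular using (atMostTwo; popular)

    f-injective : Injective _≡_ _≡_ f
    f-injective = clique-injective {R = Adj} irrefl f-clique

    atMostTwo′ : ∀ x → AtMostTwoSuccessors (ColourClass _≢_ (λ i j → col (f i) (f j)) x)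
    atMostTwo′ x {p} {q} {r} {s} (p≢q , pq) (p≢r , pr) (p≢s , ps)
      with someTwoEqual-or-injective q r s
    ... | inj₁ someTwoEqual = someTwoEqual
    ... | inj₂ qrs-injective = ⊥-elim (atMostTwo (f p) x (f ∘ triple q r s)
            (qrs-injective ∘ f-injective)
            (λ { 0F → f-clique p q p≢q ; 1F → f-clique p r p≢r ; 2F → f-clique p s p≢s })
            (λ { 0F → pq ; 1F → pr ; 2F → ps }))

    triangle′ : ∀ {p q r} → p ≢ q → q ≢ r → r ≢ p →
                SomeTwoEqual (col (f p) (f q)) (col (f q) (f r)) (col (f r) (f p))
    triangle′ {p} {q} {r} p≢q q≢r r≢p = repeatedEntry⇒someTwoEqual _
      (popular 0 (f ∘ triple p q r)
        (triple-injective p≢q (≢-sym r≢p) q≢r ∘ f-injective)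
        (λ { 0F → f-clique p q p≢q ; 1F → f-clique q r q≢r ; 2F → f-clique r p r≢p }))

onePopular-cliqueNumber≤5 : (G : Graph a ℓ) → OnePopular G k → CliqueNumberAtMost (Graph.Adj G) 5
onePopular-cliqueNumber≤5 G (_ , _ , col-popular) =
  cliqueSize≤⇒cliqueNumberAtMost {R = Graph.Adj G} λ f f-clique →
    trianglePopular-size≤5 (clique-isTrianglePopular G col-popular f-clique)

completeGraph : ℕ → Graph 0ℓ 0ℓ
completeGraph n = record { V = Fin n ; Adj = _≢_ ; sym = _∘ sym ; irrefl = λ v≢v → v≢v refl }

twoColours-repeat : (e : Fin (3 + m) → Fin 2) → ∃[ i ] ∃[ j ] i ≢ j × e i ≡ e j
twoColours-repeat e with i , j , i<j , eᵢ≡eⱼ ← pigeonhole (s≤s (s≤s (s≤s z≤n))) e =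
  i , j , <⇒≢ i<j , eᵢ≡eⱼ

pentagon : Fin 5 → Fin 5 → Fin 2
pentagon u v = if ⌊ v ≟ next u ⌋ ∨ ⌊ u ≟ next v ⌋ then 0F else 1F

pentagon-atMostTwo : ∀ x → AtMostTwoSuccessors (ColourClass _≢_ pentagon x)
pentagon-atMostTwo x (v≢a , va) (v≢b , vb) (v≢c , vc) =
  claw-free _ _ _ _ v≢a v≢b v≢c (trans va (sym vb)) (trans va (sym vc))
  where
  claw-free : ∀ v a b c → v ≢ a → v ≢ b → v ≢ c →
              pentagon v a ≡ pentagon v b → pentagon v a ≡ pentagon v c → SomeTwoEqual a b c
  claw-free = from-yes (all? λ v → all? λ a → all? λ b → all? λ c →
    ¬? (v ≟ a) →-dec ¬? (v ≟ b) →-dec ¬? (v ≟ c) →-dec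
    pentagon v a ≟ pentagon v b →-dec pentagon v a ≟ pentagon v c →-dec
    (a ≟ b ⊎-dec a ≟ c ⊎-dec b ≟ c))

pentagon-onePopular : OnePopularColoring (completeGraph 5) (Fin 2) pentagon
pentagon-onePopular = record
  { symmetric = λ u v _ → cong (if_then 0F else 1F) (∨-comm ⌊ v ≟ next u ⌋ ⌊ u ≟ next v ⌋)
  ; atMostTwo = atMostTwoSuccessors⇒atMostTwo (completeGraph 5) pentagon-atMostTwo
  ; popular   = λ _ w _ _ → twoColours-repeat (λ i → pentagon (w i) (w (next i)))
  }

module _ {b ℓ₁ ℓ₂} (O : TotalOrder b ℓ₁ ℓ₂) where
  open TotalOrder O using (Carrier) renaming (_≤_ to _⊑_; trans to ⊑-trans)
  open import Data.List.Extrema O using (argmax; f[xs]≤f[argmax])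

  Fin-argmax : (w : Fin (suc n) → Carrier) → ∃[ i ] ∀ j → w j ⊑ w i
  Fin-argmax w = argmax w 0F (allFin _) ,
                 λ j → All.lookup (f[xs]≤f[argmax] {f = w} 0F (allFin _)) (∈-allFin j)

  Fin-argmax₂ : (w : Fin (suc m) → Fin (suc n) → Carrier) →
                ∃[ i ] ∃[ j ] ∀ i′ j′ → w i′ j′ ⊑ w i j
  Fin-argmax₂ {m = m} {n = n} w = i , row-max i , λ i′ j′ → ⊑-trans (row-max-⊑ i′ j′) (i-max i′)
    where
    row-max : Fin (suc m) → Fin (suc n)
    row-max i = proj₁ (Fin-argmax (w i))

    row-max-⊑ : ∀ i j → w i j ⊑ w i (row-max i)
    row-max-⊑ i = proj₂ (Fin-argmax (w i))

    i : Fin (suc m)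
    i = proj₁ (Fin-argmax (λ i → w i (row-max i)))

    i-max : ∀ i′ → w i′ (row-max i′) ⊑ w i (row-max i)
    i-max = proj₂ (Fin-argmax (λ i → w i (row-max i)))

module _ (Γ : Group a ℓ) where
  open Group Γ renaming (sym to ≈-sym; trans to ≈-trans; refl to ≈-refl)
  open import Algebra.Properties.Group Γ
    using (⁻¹-anti-homo-\\; \\-leftDividesˡ; ∙-cancelˡ; ε⁻¹≈ε)
  open import Relation.Binary.Reasoning.Setoid setoid

  Span : ∀ {s} → (Carrier → Set s) → Carrier → Set _
  Span = ⟨_⟩ Γ

  record IsSubgroup {h} (H : Carrier → Set h) : Set (a ⊔ ℓ ⊔ h) where
    field
      ε-closed  : H ε
      ∙-closed  : ∀ {x y} → H x → H y → H (x ∙ y)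
      ⁻¹-closed : ∀ {x} → H x → H (x ⁻¹)
      ≈-closed  : ∀ {x y} → x ≈ y → H x → H y

  trivial-isSubgroup : IsSubgroup (_≈ ε)
  trivial-isSubgroup = record
    { ε-closed  = ≈-refl
    ; ∙-closed  = λ x≈ε y≈ε → ≈-trans (∙-cong x≈ε y≈ε) (identityˡ ε)
    ; ⁻¹-closed = λ x≈ε → ≈-trans (⁻¹-cong x≈ε) ε⁻¹≈ε
    ; ≈-closed  = λ x≈y x≈ε → ≈-trans (≈-sym x≈y) x≈ε
    }

  span-least : ∀ {s h} {S : Carrier → Set s} {H : Carrier → Set h} → IsSubgroup H →
               (∀ {x} → S x → H x) → ∀ {x} → Span S x → H x
  span-least H-subgroup S⊆H (gen Sx)      = S⊆H Sx
  span-least H-subgroup S⊆H unit          = IsSubgroup.ε-closed H-subgroup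
  span-least H-subgroup S⊆H (mul Hx Hy)   = IsSubgroup.∙-closed H-subgroup
    (span-least H-subgroup S⊆H Hx) (span-least H-subgroup S⊆H Hy)
  span-least H-subgroup S⊆H (inv Hx)      = IsSubgroup.⁻¹-closed H-subgroup
    (span-least H-subgroup S⊆H Hx)
  span-least H-subgroup S⊆H (resp x≈y Hx) = IsSubgroup.≈-closed H-subgroup x≈y
    (span-least H-subgroup S⊆H Hx)

  \\-trans : ∀ x y z → (x \\ y) ∙ (y \\ z) ≈ x \\ z
  \\-trans x y z = begin
    (x ⁻¹ ∙ y) ∙ (y \\ z) ≈⟨ assoc (x ⁻¹) y (y \\ z) ⟩
    x ⁻¹ ∙ (y ∙ (y \\ z)) ≈⟨ ∙-congˡ (\\-leftDividesˡ y z) ⟩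
    x \\ z                ∎

  \\-cancelˡ : ∀ x {y y′ d} → x \\ y ≈ d → x \\ y′ ≈ d → y ≈ y′
  \\-cancelˡ x {y} {y′} x\\y≈d x\\y′≈d = ∙-cancelˡ (x ⁻¹) y y′ (≈-trans x\\y≈d (≈-sym x\\y′≈d))

  ≈⇒\\≈ε : ∀ {x y} → x ≈ y → x \\ y ≈ ε
  ≈⇒\\≈ε {x} x≈y = ≈-trans (∙-congˡ (≈-sym x≈y)) (inverseˡ x)

  module _ {s} {S : Carrier → Set s} where
    span-\\-sym : ∀ {x y} → Span S (x \\ y) → Span S (y \\ x)
    span-\\-sym {x} {y} h = resp (⁻¹-anti-homo-\\ x y) (inv h)

    span-\\-trans : ∀ {x y z} → Span S (x \\ y) → Span S (y \\ z) → Span S (x \\ z)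
    span-\\-trans {x} {y} {z} h h′ = resp (\\-trans x y z) (mul h h′)

  infix 4 _—[_]—_
  _—[_]—_ : Carrier → Carrier → Carrier → Set ℓ
  x —[ d ]— y = x \\ y ≈ d ⊎ y \\ x ≈ d

  module _ {x y d : Carrier} where
    —[]—-sym : x —[ d ]— y → y —[ d ]— x
    —[]—-sym = Sum.swap

    —[]—⇒\\ : x —[ d ]— y → x \\ y ≈ d ⊎ x \\ y ≈ d ⁻¹
    —[]—⇒\\ (inj₁ x\\y≈d) = inj₁ x\\y≈d
    —[]—⇒\\ (inj₂ y\\x≈d) = inj₂ (≈-trans (≈-sym (⁻¹-anti-homo-\\ y x)) (⁻¹-cong y\\x≈d))

    module _ {s} {S : Carrier → Set s} where
      —[]—-span⁺ : x —[ d ]— y → Span S d → Span S (x \\ y)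
      —[]—-span⁺ (inj₁ x\\y≈d) Sd = resp (≈-sym x\\y≈d) Sd
      —[]—-span⁺ (inj₂ y\\x≈d) Sd = span-\\-sym (resp (≈-sym y\\x≈d) Sd)

      —[]—-span⁻ : x —[ d ]— y → Span S (x \\ y) → Span S d
      —[]—-span⁻ (inj₁ x\\y≈d) Sxy = resp x\\y≈d Sxy
      —[]—-span⁻ (inj₂ y\\x≈d) Sxy = resp y\\x≈d (span-\\-sym Sxy)

  —[]—∧≈⇒≈ε : ∀ {x y d} → x —[ d ]— y → x ≈ y → d ≈ ε
  —[]—∧≈⇒≈ε (inj₁ x\\y≈d) x≈y = ≈-trans (≈-sym x\\y≈d) (≈⇒\\≈ε x≈y)
  —[]—∧≈⇒≈ε (inj₂ y\\x≈d) x≈y = ≈-trans (≈-sym y\\x≈d) (≈⇒\\≈ε (≈-sym x≈y))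

  —[]—-atMostTwo : ∀ {x d y₁ y₂ y₃} → x —[ d ]— y₁ → x —[ d ]— y₂ → x —[ d ]— y₃ →
                   y₁ ≈ y₂ ⊎ y₁ ≈ y₃ ⊎ y₂ ≈ y₃
  —[]—-atMostTwo {x} e₁ e₂ e₃ with —[]—⇒\\ e₁ | —[]—⇒\\ e₂ | —[]—⇒\\ e₃
  ... | inj₁ d₁ | inj₁ d₂ | _       = inj₁ (\\-cancelˡ x d₁ d₂)
  ... | inj₂ d₁ | inj₂ d₂ | _       = inj₁ (\\-cancelˡ x d₁ d₂)
  ... | inj₁ d₁ | inj₂ _  | inj₁ d₃ = inj₂ (inj₁ (\\-cancelˡ x d₁ d₃))
  ... | inj₂ d₁ | inj₁ _  | inj₂ d₃ = inj₂ (inj₁ (\\-cancelˡ x d₁ d₃))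
  ... | inj₁ _  | inj₂ d₂ | inj₂ d₃ = inj₂ (inj₂ (\\-cancelˡ x d₂ d₃))
  ... | inj₂ _  | inj₁ d₂ | inj₁ d₃ = inj₂ (inj₂ (\\-cancelˡ x d₂ d₃))

  module _ {n} {c : Fin n → Carrier} (c-semiMinimal : SemiMinimal Γ c) where
    private
      c-new : ∀ t → ¬ Span (Before Γ c t) (c t)
      c-new = proj₁ c-semiMinimal

    adj⇒—[]— : ∀ {x y} → CayAdj Γ (Img Γ c) x y → ∃[ t ] x —[ c t ]— y
    adj⇒—[]— (inj₁ (t , x\\y≈cₜ)) = t , inj₁ x\\y≈cₜ
    adj⇒—[]— (inj₂ (t , y\\x≈cₜ)) = t , inj₂ y\\x≈cₜ

    generator-nontrivial : ∀ t → ¬ c t ≈ ε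
    generator-nontrivial t cₜ≈ε = c-new t (resp (≈-sym cₜ≈ε) unit)

    module CayleyClique {m} {f : Fin (2 + m) → Carrier}
                       (f-clique : IsClique (CayAdj Γ (Img Γ c)) f) where

      f-injective : ∀ {i j} → f i ≈ f j → i ≡ j
      f-injective {i} {j} fi≈fj with i ≟ j
      ... | yes i≡j = i≡j
      ... | no i≢j  with t , fi—fj ← adj⇒—[]— (f-clique i j i≢j) =
        ⊥-elim (generator-nontrivial t (—[]—∧≈⇒≈ε fi—fj fi≈fj))

      -- The edges at i are indexed by Fin (1 + m) via punchIn i, so that the
      -- labelling needs no junk value on the diagonal.
      label : Fin (2 + m) → Fin (1 + m) → Fin n
      label i j = proj₁ (adj⇒—[]— (f-clique i (punchIn i j) (punchInᵢ≢i i j ∘ sym)))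

      label-edge : ∀ i j → f i —[ c (label i j) ]— f (punchIn i j)
      label-edge i j = proj₂ (adj⇒—[]— (f-clique i (punchIn i j) (punchInᵢ≢i i j ∘ sym)))

      edge : ∀ {i z} (i≢z : i ≢ z) → f i —[ c (label i (punchOut i≢z)) ]— f z
      edge {i} i≢z = subst (λ v → f i —[ c (label i (punchOut i≢z)) ]— f v)
                           (punchIn-punchOut i≢z) (label-edge i (punchOut i≢z))

      module MaximalEdge (P : Fin (2 + m)) (j₀ : Fin (1 + m))
                         (label≤M : ∀ i j → label i j ≤ᶠ label P j₀) where
        Q : Fin (2 + m)
        Q = punchIn P j₀

        M : Fin n
        M = label P j₀

        dominated : ∀ {z} (P≢z : P ≢ z) (Q≢z : Q ≢ z) → f P —[ c M ]— f z ⊎ f Q —[ c M ]— f z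
        dominated {z} P≢z Q≢z
          with label P (punchOut P≢z) ≟ M | label Q (punchOut Q≢z) ≟ M
        ... | yes tP≡M | _        = inj₁ (subst (λ t → f P —[ c t ]— f z) tP≡M (edge P≢z))
        ... | no _     | yes tQ≡M = inj₂ (subst (λ t → f Q —[ c t ]— f z) tQ≡M (edge Q≢z))
        ... | no tP≢M  | no tQ≢M  = ⊥-elim (c-new M (—[]—-span⁻ (label-edge P j₀)
              (span-\\-trans (earlier P≢z tP≢M) (span-\\-sym (earlier Q≢z tQ≢M)))))
          where
          earlier : ∀ {i} (i≢z : i ≢ z) → label i (punchOut i≢z) ≢ M →
                    Span (Before Γ c M) (f i \\ f z)
          earlier {i} i≢z t≢M = —[]—-span⁺ (edge i≢z)
            (gen (_ , ≤∧≢⇒< (label≤M i (punchOut i≢z)) t≢M , ≈-refl))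

        others : Fin m → Fin (2 + m)
        others = punchIn P ∘ punchIn j₀

        P≢others : ∀ w → P ≢ others w
        P≢others w = punchInᵢ≢i P (punchIn j₀ w) ∘ sym

        Q≢others : ∀ w → Q ≢ others w
        Q≢others w = punchInᵢ≢i j₀ w ∘ sym ∘ punchIn-injective P j₀ (punchIn j₀ w)

        hub spare : Fin 2 → Fin (2 + m)
        hub 0F = P
        hub 1F = Q
        spare 0F = Q
        spare 1F = P

        size≤4 : m ≤ 2
        size≤4 = coveredByTwoHubs⇒≤2 {E = λ i j → f i —[ c M ]— f j}
          atMostTwo hub spare hub→spare others others-injective spare≢others cover
          where
          atMostTwo : AtMostTwoSuccessors (λ i j → f i —[ c M ]— f j)
          atMostTwo e₁ e₂ e₃ = Sum.map f-injective (Sum.map f-injective f-injective)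
                                 (—[]—-atMostTwo e₁ e₂ e₃)

          hub→spare : ∀ q → f (hub q) —[ c M ]— f (spare q)
          hub→spare 0F = label-edge P j₀
          hub→spare 1F = —[]—-sym (label-edge P j₀)

          others-injective : Injective _≡_ _≡_ others
          others-injective = punchIn-injective j₀ _ _ ∘ punchIn-injective P _ _

          spare≢others : ∀ q w → spare q ≢ others w
          spare≢others 0F = Q≢others
          spare≢others 1F = P≢others

          cover : ∀ w → ∃[ q ] f (hub q) —[ c M ]— f (others w)
          cover w = Sum.[ (0F ,_) , (1F ,_) ]′ (dominated (P≢others w) (Q≢others w))

      size≤4 : m ≤ 2
      size≤4 = let P , j₀ , label≤M = Fin-argmax₂ (≤-totalOrder n) label in
               MaximalEdge.size≤4 P j₀ label≤M

    cayleyClique-size≤4 : ∀ {r} {f : Fin r → Carrier} → IsClique (CayAdj Γ (Img Γ c)) f → r ≤ 4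
    cayleyClique-size≤4 {0}             _        = z≤n
    cayleyClique-size≤4 {1}             _        = s≤s z≤n
    cayleyClique-size≤4 {suc (suc m)}   f-clique = +-monoʳ-≤ 2 (CayleyClique.size≤4 f-clique)

semiMinimalCayley-cliqueNumber≤4 : (Γ : Group a ℓ) (n : ℕ) (c : Fin n → Group.Carrier Γ) →
  SemiMinimal Γ c → CliqueNumberAtMost (CayAdj Γ (Img Γ c)) 4
semiMinimalCayley-cliqueNumber≤4 Γ n c c-semiMinimal =
  cliqueSize≤⇒cliqueNumberAtMost {R = CayAdj Γ (Img Γ c)} λ _ →
    cayleyClique-size≤4 Γ c-semiMinimal

_+₄_ : Fin 4 → Fin 4 → Fin 4
x +₄ y = (toℕ x + toℕ y) mod 4

-₄_ : Fin 4 → Fin 4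
-₄ x = (4 ∸ toℕ x) mod 4

ℤ₄ : Group 0ℓ 0ℓ
ℤ₄ = record
  { Carrier = Fin 4 ; _≈_ = _≡_ ; _∙_ = _+₄_ ; ε = 0F ; _⁻¹ = -₄_
  ; isGroup = record
    { isMonoid = record
      { isSemigroup = record
        { isMagma = record { isEquivalence = isEquivalence ; ∙-cong = cong₂ _+₄_ }
        ; assoc   = from-yes (all? λ x → all? λ y → all? λ z → (x +₄ y) +₄ z ≟ x +₄ (y +₄ z))
        }
      ; identity = from-yes (all? λ x → 0F +₄ x ≟ x) , from-yes (all? λ x → x +₄ 0F ≟ x)
      }
    ; inverse = from-yes (all? λ x → (-₄ x) +₄ x ≟ 0F) , from-yes (all? λ x → x +₄ (-₄ x) ≟ 0F)
    ; ⁻¹-cong = cong -₄_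
    }
  }

Even : Fin 4 → Set
Even x = 2 ∣ toℕ x

evens-isSubgroup : IsSubgroup ℤ₄ Even
evens-isSubgroup = record
  { ε-closed  = from-yes (2 ∣? 0)
  ; ∙-closed  = λ {x} {y} → ∙-closed x y
  ; ⁻¹-closed = λ {x} → ⁻¹-closed x
  ; ≈-closed  = λ { refl Ex → Ex }
  }
  where
  ∙-closed : ∀ x y → Even x → Even y → Even (x +₄ y)
  ∙-closed = from-yes (all? λ x → all? λ y → 2 ∣? toℕ x →-dec 2 ∣? toℕ y →-dec 2 ∣? toℕ (x +₄ y))

  ⁻¹-closed : ∀ x → Even x → Even (-₄ x)
  ⁻¹-closed = from-yes (all? λ x → 2 ∣? toℕ x →-dec 2 ∣? toℕ (-₄ x))

ℤ₄-generators : Fin 2 → Fin 4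
ℤ₄-generators 0F = 2F
ℤ₄-generators 1F = 1F

ℤ₄-semiMinimal : SemiMinimal ℤ₄ ℤ₄-generators
ℤ₄-semiMinimal = new , generates
  where
  new : ∀ i → ¬ Span ℤ₄ (Before ℤ₄ ℤ₄-generators i) (ℤ₄-generators i)
  new 0F 2∈⟨⟩ with () ← span-least ℤ₄ (trivial-isSubgroup ℤ₄) (λ { (_ , () , _) }) 2∈⟨⟩
  new 1F 1∈⟨2⟩ = from-no (2 ∣? 1) (span-least ℤ₄ evens-isSubgroup
    (λ { (0F , _ , refl) → from-yes (2 ∣? 2) ; (1F , s≤s () , _) }) 1∈⟨2⟩)

  generates : ∀ x → Span ℤ₄ (Img ℤ₄ ℤ₄-generators) x
  generates 0F = unit
  generates 1F = gen (1F , refl)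
  generates 2F = gen (0F , refl)
  generates 3F = mul (gen (1F , refl)) (gen (0F , refl))

ℤ₄-clique : IsClique (CayAdj ℤ₄ (Img ℤ₄ ℤ₄-generators)) (λ x → x)
ℤ₄-clique = from-yes (all? λ x → all? λ y → ¬? (x ≟ y) →-dec
  (any? (λ t → (-₄ x) +₄ y ≟ ℤ₄-generators t) ⊎-dec any? (λ t → (-₄ y) +₄ x ≟ ℤ₄-generators t)))

proposition3p2 : ∀ {a ℓ k : Level} →
  -- (i) every one popular color graph has ω ≤ 5
  (((G : Graph a ℓ) → OnePopular G k → CliqueNumberAtMost (Graph.Adj G) 5)
  -- (ii) every semiminimal Cayley graph has ω ≤ 4
  × ((Γ : Group a ℓ) (n : ℕ) (c : Fin n → Group.Carrier Γ) →
       SemiMinimal Γ c → CliqueNumberAtMost (CayAdj Γ (Img Γ c)) 4))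
  -- (i) some one popular color graph has ω = 5
  × (Σ (Graph 0ℓ 0ℓ) λ G → OnePopular G 0ℓ × CliqueNumber (Graph.Adj G) 5)
  -- (ii) some semiminimal Cayley graph has ω = 4
  × (Σ (Group 0ℓ 0ℓ) λ Γ → Σ ℕ λ n → Σ (Fin n → Group.Carrier Γ) λ c →
       SemiMinimal Γ c × CliqueNumber (CayAdj Γ (Img Γ c)) 4)
proposition3p2 =
  (onePopular-cliqueNumber≤5 , semiMinimalCayley-cliqueNumber≤4) ,
  (completeGraph 5 , pentagon-popular , ((λ x → x) , λ _ _ i≢j → i≢j) ,
   onePopular-cliqueNumber≤5 (completeGraph 5) pentagon-popular) ,
  (ℤ₄ , 2 , ℤ₄-generators , ℤ₄-semiMinimal , ((λ x → x) , ℤ₄-clique) ,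
   semiMinimalCayley-cliqueNumber≤4 ℤ₄ 2 ℤ₄-generators ℤ₄-semiMinimal)
  where
  pentagon-popular : OnePopular (completeGraph 5) 0ℓ
  pentagon-popular = Fin 2 , pentagon , pentagon-onePopular
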